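{- Let $S\subseteq\Pi$ and let $w^*_S$ be the longest element of the subgroup of the Weyl group $W$ generated by the reflections $s_\alpha$, $\alpha\in\Pi\setminus S$. Let $I_{F_S}=\{\beta\in\Phi\mid c_\alpha(\beta)=m_\alpha \text{ for all }\alpha\in S\}$. Then $w^*_S$ maps $I_{F_S}$ onto itself and its restriction to $I_{F_S}$ is an anti-isomorphism of the poset $(I_{F_S},\le)$ (an order-reversing bijection). In particular, $I_{F_S}$ has a minimum $\mu_S$ and $w^*_S$ exchanges $\theta$ and $\mu_S$.
   Context: $\Phi$ is an irreducible crystallographic root system in a Euclidean space $E$, $\Phi^+$ a positive system with simple system $\Pi$, $W$ the Weyl group. For $\alpha\in\Pi$, $\beta\in\Phi$, $c_\alpha(\beta)$ is the coefficient of $\alpha$ in $\beta$; $\theta$ is the highest root and $m_\alpha=c_\alpha(\theta)$. The standard partial order: $x\le y$ iff $y-x$ is a nonnegative integer combination of $\Pi$.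
   Formalization: The root system $\Phi$ consists of vectors with rational coordinates in ℚ^N, carrying the standard inner product, instead of lying in a real Euclidean space $E$. -}

module Defs where

open import Data.Nat using (ℕ; zero; suc)
open import Data.Integer using (ℤ)
open import Data.Fin using (Fin)
open import Data.Fin.Subset using (Subset; _∈_; _∉_)
open import Data.Rational using (ℚ; 0ℚ; 1ℚ; -_; _+_; _-_; _*_; _≤_; _/_; 1/_; ≢-nonZero)
open import Data.Rational.Properties using (_≟_)
open import Data.List using (List; []; _∷_; length)
open import Data.List.Relation.Unary.Any using (Any)
open import Data.List.Relation.Unary.All using (All)
open import Data.Product using (Σ; ∃; ∃-syntax; _×_; _,_)
open import Data.Sum using (_⊎_)
open import Data.Bool using (Bool; true; false)
open import Data.Empty using (⊥)
open import Relation.Nullary using (¬_; yes; no)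
open import Relation.Binary.PropositionalEquality using (_≡_)
import Data.Nat as ℕ

Vecℚ : ℕ → Set
Vecℚ N = Fin N → ℚ

∑ : ∀ {n} → (Fin n → ℚ) → ℚ
∑ {zero}  f = 0ℚ
∑ {suc n} f = f Fin.zero + ∑ (λ i → f (Fin.suc i))
  where import Data.Fin as Fin

0ᵥ : ∀ {N} → Vecℚ N
0ᵥ _ = 0ℚ

_+ᵥ_ : ∀ {N} → Vecℚ N → Vecℚ N → Vecℚ N
(u +ᵥ v) i = u i + v i

_-ᵥ_ : ∀ {N} → Vecℚ N → Vecℚ N → Vecℚ N
(u -ᵥ v) i = u i - v i

-ᵥ_ : ∀ {N} → Vecℚ N → Vecℚ N
(-ᵥ u) i = - (u i)

_·ᵥ_ : ∀ {N} → ℚ → Vecℚ N → Vecℚ N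
(c ·ᵥ u) i = c * u i

⟪_,_⟫ : ∀ {N} → Vecℚ N → Vecℚ N → ℚ
⟪ u , v ⟫ = ∑ (λ i → u i * v i)

_≈ᵥ_ : ∀ {N} → Vecℚ N → Vecℚ N → Set
u ≈ᵥ v = ∀ i → u i ≡ v i

-- total inverse (1/0 := 0); only ever applied to ⟪ α , α ⟫ with α ≠ 0
inv : ℚ → ℚ
inv q with q ≟ 0ℚ
... | yes _ = 0ℚ
... | no q≢0 = 1/_ q {{≢-nonZero q≢0}}

cartan : ∀ {N} → Vecℚ N → Vecℚ N → ℚ
cartan β α = (2ℚ * ⟪ β , α ⟫) * inv ⟪ α , α ⟫
  where 2ℚ = 1ℚ + 1ℚ

refl_ : ∀ {N} → Vecℚ N → Vecℚ N → Vecℚ N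
refl_ α v = v -ᵥ (cartan v α ·ᵥ α)

fromℤ : ℤ → ℚ
fromℤ k = k / 1

_∈Φ_ : ∀ {N} → Vecℚ N → List (Vecℚ N) → Set
β ∈Φ Φ = Any (λ γ → β ≈ᵥ γ) Φ

record IsRootSystem {N : ℕ} (Φ : List (Vecℚ N)) : Set where
  field
    nonzero  : ∀ α → α ∈Φ Φ → ¬ (α ≈ᵥ 0ᵥ)
    multiples : ∀ α (c : ℚ) → α ∈Φ Φ → (c ·ᵥ α) ∈Φ Φ → (c ≡ 1ℚ) ⊎ (c ≡ - 1ℚ)
    reflClosed : ∀ α β → α ∈Φ Φ → β ∈Φ Φ → (refl_ α β) ∈Φ Φ
    crystallographic : ∀ α β → α ∈Φ Φ → β ∈Φ Φ → ∃[ k ] (cartan β α ≡ fromℤ k)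

Irreducible : ∀ {N} → List (Vecℚ N) → Set
Irreducible {N} Φ =
  (P : Vecℚ N → Bool) →
  (∀ α β → α ∈Φ Φ → β ∈Φ Φ → P α ≡ true → P β ≡ false → ⟪ α , β ⟫ ≡ 0ℚ) →
  (∀ α → α ∈Φ Φ → P α ≡ true) ⊎ (∀ α → α ∈Φ Φ → P α ≡ false)

lin : ∀ {N r} → (Fin r → Vecℚ N) → (Fin r → ℚ) → Vecℚ N
lin Π c i = ∑ (λ j → c j * Π j i)

ℕtoℚ : ℕ → ℚ
ℕtoℚ n = Data.Integer.+_ n / 1
  where import Data.Integer

record IsSimpleSystem {N r : ℕ} (Φ : List (Vecℚ N)) (Π : Fin r → Vecℚ N) : Set where
  field
    inΦ : ∀ i → Π i ∈Φ Φ
    linIndep : ∀ (c : Fin r → ℚ) → lin Π c ≈ᵥ 0ᵥ → ∀ i → c i ≡ 0ℚ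
    sameSign : ∀ β → β ∈Φ Φ → ∃[ c ] (β ≈ᵥ lin Π c ×
                 ((∀ i → 0ℚ ≤ c i) ⊎ (∀ i → c i ≤ 0ℚ)))

_≼[_]_ : ∀ {N r} → Vecℚ N → (Fin r → Vecℚ N) → Vecℚ N → Set
x ≼[ Π ] y = Σ (Fin _ → ℕ) λ k → (y -ᵥ x) ≈ᵥ lin Π (λ i → ℕtoℚ (k i))

IsHighestRoot : ∀ {N r} → List (Vecℚ N) → (Fin r → Vecℚ N) → Vecℚ N → Set
IsHighestRoot Φ Π θ = θ ∈Φ Φ × (∀ β → β ∈Φ Φ → β ≼[ Π ] θ)

-- I_{F_S} = { β ∈ Φ | c_α(β) = m_α = c_α(θ) for all α ∈ S }
InIF : ∀ {N r} → List (Vecℚ N) → (Fin r → Vecℚ N) → Vecℚ N → Subset r → Vecℚ N → Set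
InIF Φ Π θ S β = β ∈Φ Φ × ∃[ c ] ∃[ d ] (β ≈ᵥ lin Π c × θ ≈ᵥ lin Π d × (∀ i → i ∈ S → c i ≡ d i))

-- Weyl group elements as words in the simple reflections

act : ∀ {N r} → (Fin r → Vecℚ N) → List (Fin r) → Vecℚ N → Vecℚ N
act Π []      v = v
act Π (i ∷ w) v = refl_ (Π i) (act Π w v)

SameElt : ∀ {N r} → (Fin r → Vecℚ N) → List (Fin r) → List (Fin r) → Set
SameElt Π w u = ∀ v → act Π w v ≈ᵥ act Π u v

LengthAtMost : ∀ {N r} → (Fin r → Vecℚ N) → List (Fin r) → ℕ → Set
LengthAtMost Π w L = ∃[ u ] (length u ℕ.≤ L × SameElt Π w u)

HasLength : ∀ {N r} → (Fin r → Vecℚ N) → List (Fin r) → ℕ → Set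
HasLength Π w L = LengthAtMost Π w L × (∀ u → SameElt Π w u → L ℕ.≤ length u)

InParabolic : ∀ {r} → Subset r → List (Fin r) → Set
InParabolic S w = All (λ i → i ∉ S) w

IsLongestParabolic : ∀ {N r} → (Fin r → Vecℚ N) → Subset r → List (Fin r) → Set
IsLongestParabolic Π S w =
  InParabolic S w × ∃[ L ] (HasLength Π w L × (∀ u → InParabolic S u → LengthAtMost Π u L))

module Submission where

-- For β, γ ∈ I_{F_S} the coordinates on S agree (they are those of θ), so if β ≤ γ then γ − β is a
-- nonnegative integer combination of the simple roots outside S.  The longest element w of W_{Π∖S}
-- sends each of these simple roots to a negative root, since otherwise w s_α would be longer
-- (exchange condition); and being a product of the s_α, α ∉ S, it keeps the coordinates on S.
-- Hence w maps I_{F_S} into itself and reverses ≤ there.  As w⁻¹ is again the longest element,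
-- w is an anti-automorphism of (I_{F_S}, ≤); it sends the maximum θ to the minimum μ_S, and since
-- w⁻¹ θ = μ_S as well, w μ_S = θ.

open import Data.Nat as ℕ using (ℕ; zero; suc)
import Data.Nat.Properties as ℕ
open import Data.Integer as ℤ using (ℤ; -[1+_])
import Data.Integer.Properties as ℤ
import Data.Nat.Coprimality as Coprime
open import Data.Rational using (ℚ; mkℚ; ↥_; 0ℚ; 1ℚ; -_; _+_; _-_; _*_; _≤_; *≤*; ≢-nonZero; nonNegative; nonPositive; positive; negative)
open import Data.Rational.Properties
open import Data.Rational.Solver using (module +-*-Solver)
open +-*-Solver
open import Data.Fin as Fin using (Fin; zero; suc)
open import Data.Fin.Subset using (Subset; _∈_; _∉_)
open import Data.Fin.Subset.Properties using (_∈?_)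
open import Data.List using (List; []; _∷_; _∷ʳ_; length; reverse)
import Data.List.Properties as List
open import Data.List.Relation.Unary.All using (All; []; _∷_)
import Data.List.Relation.Unary.Any as Any
import Data.List.Relation.Unary.All.Properties as All
open import Data.Vec.Functional.Relation.Binary.Equality.Setoid ≡-setoid
  using (≋-refl; ≋-sym; ≋-trans; ≋-setoid)
import Relation.Binary.Reasoning.Setoid as SetoidReasoning
open import Data.Product using (Σ; ∃-syntax; _×_; _,_; proj₁; proj₂)
open import Data.Sum using (_⊎_; inj₁; inj₂)
open import Data.Empty using (⊥; ⊥-elim)
open import Relation.Nullary using (¬_; yes; no)
open import Relation.Binary.Definitions using (tri<; tri≈; tri>)
open import Relation.Binary.PropositionalEquality
open import Function using (_∘_)
open import Defs

square-nonNeg : ∀ x → 0ℚ ≤ x * x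
square-nonNeg x with ≤-total 0ℚ x
... | inj₁ 0≤x = subst (_≤ x * x) (*-zeroʳ x) (*-monoˡ-≤-nonNeg x {{nonNegative 0≤x}} 0≤x)
... | inj₂ x≤0 = subst (_≤ x * x) (*-zeroʳ x) (*-monoˡ-≤-nonPos x {{nonPositive x≤0}} x≤0)

square≡0⇒≡0 : ∀ x → x * x ≡ 0ℚ → x ≡ 0ℚ
square≡0⇒≡0 x x²≡0 with <-cmp x 0ℚ
... | tri≈ _ x≡0 _ = x≡0
... | tri< x<0 _ _ = ⊥-elim (<-irrefl (trans (*-zeroʳ x) (sym x²≡0)) (*-monoʳ-<-neg x {{negative x<0}} x<0))
... | tri> _ _ x>0 = ⊥-elim (<-irrefl (trans (*-zeroʳ x) (sym x²≡0)) (*-monoʳ-<-pos x {{positive x>0}} x>0))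

nonNeg+nonNeg≡0⇒≡0 : ∀ {x y} → 0ℚ ≤ x → 0ℚ ≤ y → x + y ≡ 0ℚ → x ≡ 0ℚ
nonNeg+nonNeg≡0⇒≡0 {x} 0≤x 0≤y x+y≡0 =
  ≤-antisym (subst₂ _≤_ (+-identityʳ x) x+y≡0 (+-monoʳ-≤ x 0≤y)) 0≤x

0≰-1 : ¬ (0ℚ ≤ - 1ℚ)
0≰-1 (*≤* ())

mkℚ-integer : ℤ → ℚ
mkℚ-integer z = mkℚ z 0 (Coprime.sym (Coprime.1-coprimeTo ℤ.∣ z ∣))

-- On the normal form with denominator 1, + and * of ℚ compute as on ℤ.
fromℤ≡mkℚ-integer : ∀ z → fromℤ z ≡ mkℚ-integer z
fromℤ≡mkℚ-integer z = ↥p/↧p≡p (mkℚ-integer z)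

fromℤ-+ : ∀ a b → fromℤ (a ℤ.+ b) ≡ fromℤ a + fromℤ b
fromℤ-+ a b rewrite fromℤ≡mkℚ-integer a | fromℤ≡mkℚ-integer b =
  cong fromℤ (sym (cong₂ ℤ._+_ (ℤ.*-identityʳ a) (ℤ.*-identityʳ b)))

fromℤ-* : ∀ a b → fromℤ (a ℤ.* b) ≡ fromℤ a * fromℤ b
fromℤ-* a b rewrite fromℤ≡mkℚ-integer a | fromℤ≡mkℚ-integer b = refl

fromℤ-neg : ∀ a → fromℤ (ℤ.- a) ≡ - fromℤ a
fromℤ-neg a rewrite fromℤ≡mkℚ-integer a | fromℤ≡mkℚ-integer (ℤ.- a) = neg-mkℚ-integer a
  where
  neg-mkℚ-integer : ∀ a → mkℚ-integer (ℤ.- a) ≡ - mkℚ-integer a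
  neg-mkℚ-integer (ℤ.+ zero)  = refl
  neg-mkℚ-integer (ℤ.+ suc n) = refl
  neg-mkℚ-integer -[1+ n ]    = refl

fromℤ-nonPos : ∀ z → fromℤ z ≤ 0ℚ → fromℤ z ≡ - ℕtoℚ ℤ.∣ z ∣
fromℤ-nonPos (ℤ.+ zero)  _ = refl
fromℤ-nonPos (ℤ.+ suc n) z≤0 rewrite fromℤ≡mkℚ-integer (ℤ.+ suc n) with z≤0
... | *≤* (ℤ.+≤+ ())
fromℤ-nonPos -[1+ n ]    _ = fromℤ-neg (ℤ.+ suc n)

ℕtoℚ-+ : ∀ m n → ℕtoℚ (m ℕ.+ n) ≡ ℕtoℚ m + ℕtoℚ n
ℕtoℚ-+ m n = fromℤ-+ (ℤ.+ m) (ℤ.+ n)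

ℕtoℚ-* : ∀ m n → ℕtoℚ (m ℕ.* n) ≡ ℕtoℚ m * ℕtoℚ n
ℕtoℚ-* m n = trans (cong fromℤ (ℤ.pos-* m n)) (fromℤ-* (ℤ.+ m) (ℤ.+ n))

ℕtoℚ-nonNeg : ∀ n → 0ℚ ≤ ℕtoℚ n
ℕtoℚ-nonNeg n = nonNegative⁻¹ (ℕtoℚ n) {{normalize-nonNeg n 1}}

ℕtoℚ≡0⇒≡0 : ∀ n → ℕtoℚ n ≡ 0ℚ → n ≡ 0
ℕtoℚ≡0⇒≡0 zero    _ = refl
ℕtoℚ≡0⇒≡0 (suc n) e with cong ↥_ (trans (sym (fromℤ≡mkℚ-integer (ℤ.+ suc n))) e)
... | ()

∑-cong : ∀ {n} {f g : Fin n → ℚ} → (∀ i → f i ≡ g i) → ∑ f ≡ ∑ g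
∑-cong {zero}  f≗g = refl
∑-cong {suc n} f≗g = cong₂ _+_ (f≗g zero) (∑-cong (f≗g ∘ suc))

∑-distrib-+ : ∀ {n} (f g : Fin n → ℚ) → ∑ (λ i → f i + g i) ≡ ∑ f + ∑ g
∑-distrib-+ {zero}  f g = refl
∑-distrib-+ {suc n} f g =
  trans (cong (f zero + g zero +_) (∑-distrib-+ (f ∘ suc) (g ∘ suc)))
        (solve 4 (λ a b c d → a :+ b :+ (c :+ d) := a :+ c :+ (b :+ d)) refl
               (f zero) (g zero) (∑ (f ∘ suc)) (∑ (g ∘ suc)))

∑-*ˡ : ∀ {n} c (f : Fin n → ℚ) → ∑ (λ i → c * f i) ≡ c * ∑ f
∑-*ˡ {zero}  c f = sym (*-zeroʳ c)
∑-*ˡ {suc n} c f = trans (cong (c * f zero +_) (∑-*ˡ c (f ∘ suc))) (sym (*-distribˡ-+ c (f zero) _))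

∑-zero : ∀ {n} → ∑ {n} (λ _ → 0ℚ) ≡ 0ℚ
∑-zero {zero}  = refl
∑-zero {suc n} = cong (0ℚ +_) (∑-zero {n})

∑-nonNeg : ∀ {n} (f : Fin n → ℚ) → (∀ i → 0ℚ ≤ f i) → 0ℚ ≤ ∑ f
∑-nonNeg {zero}  f 0≤f = ≤-refl
∑-nonNeg {suc n} f 0≤f = +-mono-≤ (0≤f zero) (∑-nonNeg (f ∘ suc) (0≤f ∘ suc))

∑-nonNeg≡0⇒≡0 : ∀ {n} (f : Fin n → ℚ) → (∀ i → 0ℚ ≤ f i) → ∑ f ≡ 0ℚ → ∀ i → f i ≡ 0ℚ
∑-nonNeg≡0⇒≡0 {suc n} f 0≤f ∑≡0 zero = nonNeg+nonNeg≡0⇒≡0 (0≤f zero) (∑-nonNeg _ (0≤f ∘ suc)) ∑≡0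
∑-nonNeg≡0⇒≡0 {suc n} f 0≤f ∑≡0 (suc i) =
  ∑-nonNeg≡0⇒≡0 (f ∘ suc) (0≤f ∘ suc)
    (nonNeg+nonNeg≡0⇒≡0 (∑-nonNeg _ (0≤f ∘ suc)) (0≤f zero) (trans (+-comm _ (f zero)) ∑≡0)) i

δ : ∀ {n} → Fin n → Fin n → ℕ
δ zero    zero    = 1
δ zero    (suc j) = 0
δ (suc i) zero    = 0
δ (suc i) (suc j) = δ i j

δ-diag : ∀ {n} (i : Fin n) → δ i i ≡ 1
δ-diag zero    = refl
δ-diag (suc i) = δ-diag i

δ-off : ∀ {n} {i j : Fin n} → i ≢ j → δ i j ≡ 0
δ-off {i = zero}  {zero}  i≢j = ⊥-elim (i≢j refl)
δ-off {i = zero}  {suc j} i≢j = refl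
δ-off {i = suc i} {zero}  i≢j = refl
δ-off {i = suc i} {suc j} i≢j = δ-off (i≢j ∘ cong suc)

∑-δ : ∀ {n} (i : Fin n) (f : Fin n → ℚ) → ∑ (λ j → ℕtoℚ (δ i j) * f j) ≡ f i
∑-δ {suc n} zero    f = trans (cong₂ _+_ (*-identityˡ (f zero))
                                          (trans (∑-cong (λ j → *-zeroˡ (f (suc j)))) (∑-zero {n})))
                              (+-identityʳ (f zero))
∑-δ         (suc i) f = trans (cong₂ _+_ (*-zeroˡ (f zero)) (∑-δ i (f ∘ suc))) (+-identityˡ _)

two : ℚ
two = 1ℚ + 1ℚ

module ≈ᵥ-Reasoning (N : ℕ) = SetoidReasoning (≋-setoid N)

module _ {N : ℕ} where

  ⟪⟫-cong : {u u' v v' : Vecℚ N} → u ≈ᵥ u' → v ≈ᵥ v' → ⟪ u , v ⟫ ≡ ⟪ u' , v' ⟫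
  ⟪⟫-cong u≈u' v≈v' = ∑-cong (λ i → cong₂ _*_ (u≈u' i) (v≈v' i))

  ⟪⟫-sym : (u v : Vecℚ N) → ⟪ u , v ⟫ ≡ ⟪ v , u ⟫
  ⟪⟫-sym u v = ∑-cong (λ i → *-comm (u i) (v i))

  ⟪⟫-+ˡ : (u v w : Vecℚ N) → ⟪ u +ᵥ v , w ⟫ ≡ ⟪ u , w ⟫ + ⟪ v , w ⟫
  ⟪⟫-+ˡ u v w = trans (∑-cong (λ i → *-distribʳ-+ (w i) (u i) (v i))) (∑-distrib-+ {N} _ _)

  ⟪⟫-·ˡ : (c : ℚ) (u w : Vecℚ N) → ⟪ c ·ᵥ u , w ⟫ ≡ c * ⟪ u , w ⟫
  ⟪⟫-·ˡ c u w = trans (∑-cong (λ i → *-assoc c (u i) (w i))) (∑-*ˡ {N} c _)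

  ⟪⟫-minus-scaledˡ : (c : ℚ) (u a w : Vecℚ N) → ⟪ u -ᵥ (c ·ᵥ a) , w ⟫ ≡ ⟪ u , w ⟫ - c * ⟪ a , w ⟫
  ⟪⟫-minus-scaledˡ c u a w =
    trans (∑-cong (λ i → solve 4 (λ x y z k → (x :- k :* y) :* z := x :* z :+ (:- k) :* (y :* z))
                                 refl (u i) (a i) (w i) c))
          (trans (∑-distrib-+ {N} _ _)
                 (trans (cong (⟪ u , w ⟫ +_) (∑-*ˡ {N} (- c) _))
                        (solve 3 (λ x k y → x :+ (:- k) :* y := x :- k :* y) refl ⟪ u , w ⟫ c ⟪ a , w ⟫)))

  ⟪⟫-self≡0⇒≈0 : (a : Vecℚ N) → ⟪ a , a ⟫ ≡ 0ℚ → a ≈ᵥ 0ᵥ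
  ⟪⟫-self≡0⇒≈0 a ⟪a,a⟫≡0 i =
    square≡0⇒≡0 (a i) (∑-nonNeg≡0⇒≡0 (λ i → a i * a i) (λ i → square-nonNeg (a i)) ⟪a,a⟫≡0 i)

  cartan-cong : {u u' a a' : Vecℚ N} → u ≈ᵥ u' → a ≈ᵥ a' → cartan u a ≡ cartan u' a'
  cartan-cong u≈u' a≈a' =
    cong₂ (λ x y → (two * x) * inv y) (⟪⟫-cong u≈u' a≈a') (⟪⟫-cong a≈a' a≈a')

  cartan-+ˡ : (u v a : Vecℚ N) → cartan (u +ᵥ v) a ≡ cartan u a + cartan v a
  cartan-+ˡ u v a rewrite ⟪⟫-+ˡ u v a =
    solve 4 (λ t x y z → (t :* (x :+ y)) :* z := (t :* x) :* z :+ (t :* y) :* z) refl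
          two ⟪ u , a ⟫ ⟪ v , a ⟫ (inv ⟪ a , a ⟫)

  cartan-·ˡ : (c : ℚ) (u a : Vecℚ N) → cartan (c ·ᵥ u) a ≡ c * cartan u a
  cartan-·ˡ c u a rewrite ⟪⟫-·ˡ c u a =
    solve 4 (λ t c x z → (t :* (c :* x)) :* z := c :* ((t :* x) :* z)) refl
          two c ⟪ u , a ⟫ (inv ⟪ a , a ⟫)

  cartan-minus-scaledˡ : (c : ℚ) (u a b : Vecℚ N) → cartan (u -ᵥ (c ·ᵥ a)) b ≡ cartan u b - c * cartan a b
  cartan-minus-scaledˡ c u a b = trans (cong (λ x → (two * x) * inv ⟪ b , b ⟫) (⟪⟫-minus-scaledˡ c u a b)) (
    solve 5 (λ t p c q z → (t :* (p :- c :* q)) :* z := (t :* p) :* z :- c :* ((t :* q) :* z)) refl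
          two ⟪ u , b ⟫ c ⟪ a , b ⟫ (inv ⟪ b , b ⟫))

record IsLinear {M N : ℕ} (f : Vecℚ M → Vecℚ N) : Set where
  field
    cong-≈ : ∀ {u v} → u ≈ᵥ v → f u ≈ᵥ f v
    +-homo : ∀ u v → f (u +ᵥ v) ≈ᵥ (f u +ᵥ f v)
    ·-homo : ∀ c u → f (c ·ᵥ u) ≈ᵥ (c ·ᵥ f u)

  0-homo : f 0ᵥ ≈ᵥ 0ᵥ
  0-homo i = trans (cong-≈ (λ j → sym (*-zeroˡ 0ℚ)) i) (trans (·-homo 0ℚ 0ᵥ i) (*-zeroˡ (f 0ᵥ i)))

  -‿homo : ∀ u → f (-ᵥ u) ≈ᵥ (-ᵥ f u)
  -‿homo u i = trans (cong-≈ (λ j → -‿as-* (u j)) i) (trans (·-homo (- 1ℚ) u i) (sym (-‿as-* (f u i))))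
    where
    -‿as-* : ∀ x → - x ≡ - 1ℚ * x
    -‿as-* = solve 1 (λ x → :- x := (:- con 1ℚ) :* x) refl

  -ᵥ-homo : ∀ u v → f (u -ᵥ v) ≈ᵥ (f u -ᵥ f v)
  -ᵥ-homo u v i = trans (+-homo u (-ᵥ v) i) (cong (f u i +_) (-‿homo v i))

  lin-homo : ∀ {m} (G : Fin m → Vecℚ M) c → f (lin G c) ≈ᵥ lin (f ∘ G) c
  lin-homo {zero}  G c = 0-homo
  lin-homo {suc m} G c i =
    trans (+-homo (c zero ·ᵥ G zero) (lin (G ∘ suc) (c ∘ suc)) i)
          (cong₂ _+_ (·-homo (c zero) (G zero) i) (lin-homo (G ∘ suc) (c ∘ suc) i))

idᵥ-isLinear : ∀ {N} → IsLinear {N} (λ v → v)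
idᵥ-isLinear = record { cong-≈ = λ u≈v → u≈v ; +-homo = λ _ _ _ → refl ; ·-homo = λ _ _ _ → refl }

∘-isLinear : ∀ {L M N} {f : Vecℚ M → Vecℚ N} {g : Vecℚ L → Vecℚ M} → IsLinear f → IsLinear g → IsLinear (f ∘ g)
∘-isLinear {f = f} {g} F G = record
  { cong-≈ = F.cong-≈ ∘ G.cong-≈
  ; +-homo = λ u v → ≋-trans (F.cong-≈ (G.+-homo u v)) (F.+-homo (g u) (g v))
  ; ·-homo = λ c u → ≋-trans (F.cong-≈ (G.·-homo c u)) (F.·-homo c (g u))
  }
  where
  module F = IsLinear F
  module G = IsLinear G

neg-isLinear : ∀ {N} → IsLinear {N} (λ v → -ᵥ v)
neg-isLinear = record
  { cong-≈ = λ u≈v i → cong -_ (u≈v i)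
  ; +-homo = λ u v i → neg-distrib-+ (u i) (v i)
  ; ·-homo = λ c u i → neg-distribʳ-* c (u i)
  }

module _ {N : ℕ} where

  refl-+ : (a u v : Vecℚ N) → refl_ a (u +ᵥ v) ≈ᵥ (refl_ a u +ᵥ refl_ a v)
  refl-+ a u v i rewrite cartan-+ˡ u v a =
    solve 5 (λ x y p q e → x :+ y :- (p :+ q) :* e := (x :- p :* e) :+ (y :- q :* e)) refl
          (u i) (v i) (cartan u a) (cartan v a) (a i)

  refl-· : (a : Vecℚ N) (c : ℚ) (u : Vecℚ N) → refl_ a (c ·ᵥ u) ≈ᵥ (c ·ᵥ refl_ a u)
  refl-· a c u i rewrite cartan-·ˡ c u a =
    solve 4 (λ c x p e → c :* x :- c :* p :* e := c :* (x :- p :* e)) refl c (u i) (cartan u a) (a i)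

  refl-cong : {a a' u u' : Vecℚ N} → a ≈ᵥ a' → u ≈ᵥ u' → refl_ a u ≈ᵥ refl_ a' u'
  refl-cong a≈a' u≈u' i = cong₂ _-_ (u≈u' i) (cong₂ _*_ (cartan-cong u≈u' a≈a') (a≈a' i))

  refl-isLinear : (a : Vecℚ N) → IsLinear (refl_ a)
  refl-isLinear a = record { cong-≈ = refl-cong ≋-refl ; +-homo = refl-+ a ; ·-homo = refl-· a }

  module Reflection (a : Vecℚ N) (a≉0 : ¬ a ≈ᵥ 0ᵥ) where

    inv-⟪a,a⟫ : inv ⟪ a , a ⟫ * ⟪ a , a ⟫ ≡ 1ℚ
    inv-⟪a,a⟫ with ⟪ a , a ⟫ ≟ 0ℚ | ⟪⟫-self≡0⇒≈0 a
    ... | yes ⟪a,a⟫≡0 | ≈0 = ⊥-elim (a≉0 (≈0 ⟪a,a⟫≡0))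
    ... | no  ⟪a,a⟫≢0 | _  = *-inverseˡ ⟪ a , a ⟫ {{≢-nonZero ⟪a,a⟫≢0}}

    cartan-self : cartan a a ≡ two
    cartan-self =
      trans (solve 3 (λ t x z → (t :* x) :* z := t :* (z :* x)) refl two ⟪ a , a ⟫ (inv ⟪ a , a ⟫))
            (trans (cong (two *_) inv-⟪a,a⟫) (*-identityʳ two))

    refl-self : refl_ a a ≈ᵥ (-ᵥ a)
    refl-self i = trans (cong (λ t → a i - t * a i) cartan-self)
                        (solve 1 (λ x → x :- (con 1ℚ :+ con 1ℚ) :* x := :- x) refl (a i))

    cartan-refl : (v : Vecℚ N) → cartan (refl_ a v) a ≡ - cartan v a
    cartan-refl v = trans (cartan-minus-scaledˡ (cartan v a) v a a)
      (trans (cong (λ t → cartan v a - cartan v a * t) cartan-self)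
             (solve 1 (λ c → c :- c :* (con 1ℚ :+ con 1ℚ) := :- c) refl (cartan v a)))

    refl-involutive : (v : Vecℚ N) → refl_ a (refl_ a v) ≈ᵥ v
    refl-involutive v i = trans (cong (λ t → refl_ a v i - t * a i) (cartan-refl v))
      (solve 3 (λ x c e → x :- c :* e :- (:- c) :* e := x) refl (v i) (cartan v a) (a i))

    refl-isometry : (u v : Vecℚ N) → ⟪ refl_ a u , refl_ a v ⟫ ≡ ⟪ u , v ⟫
    refl-isometry u v = begin
        ⟪ refl_ a u , refl_ a v ⟫
      ≡⟨ ⟪⟫-minus-scaledˡ p u a (refl_ a v) ⟩
        ⟪ u , refl_ a v ⟫ - p * ⟪ a , refl_ a v ⟫
      ≡⟨ cong₂ (λ x y → x - p * y) (trans (⟪⟫-sym u _) (⟪⟫-minus-scaledˡ q v a u))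
                                   (trans (⟪⟫-sym a _) (⟪⟫-minus-scaledˡ q v a a)) ⟩
        (⟪ v , u ⟫ - q * ⟪ a , u ⟫) - p * (⟪ v , a ⟫ - q * A)
      ≡⟨ cong₂ (λ x y → (x - q * y) - p * (⟪ v , a ⟫ - q * A)) (⟪⟫-sym v u) (⟪⟫-sym a u) ⟩
        (⟪ u , v ⟫ - q * ⟪ u , a ⟫) - p * (⟪ v , a ⟫ - q * A)
      ≡⟨ solve 5 (λ P X Y z w →
           (P :- ((con two :* Y) :* z) :* X) :- ((con two :* X) :* z) :* (Y :- ((con two :* Y) :* z) :* w)
           := P :+ (con two :* X :* Y :* z) :* (con two :* (z :* w) :- con two))
           refl ⟪ u , v ⟫ ⟪ u , a ⟫ ⟪ v , a ⟫ ι A ⟩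
        ⟪ u , v ⟫ + (two * ⟪ u , a ⟫ * ⟪ v , a ⟫ * ι) * (two * (ι * A) - two)
      ≡⟨ cong (λ t → ⟪ u , v ⟫ + (two * ⟪ u , a ⟫ * ⟪ v , a ⟫ * ι) * (two * t - two)) inv-⟪a,a⟫ ⟩
        ⟪ u , v ⟫ + (two * ⟪ u , a ⟫ * ⟪ v , a ⟫ * ι) * 0ℚ
      ≡⟨ trans (cong (⟪ u , v ⟫ +_) (*-zeroʳ (two * ⟪ u , a ⟫ * ⟪ v , a ⟫ * ι))) (+-identityʳ ⟪ u , v ⟫) ⟩
        ⟪ u , v ⟫ ∎
      where
      open ≡-Reasoning
      A ι p q : ℚ
      A = ⟪ a , a ⟫
      ι = inv A
      p = cartan u a
      q = cartan v a

    refl-conj : (b v : Vecℚ N) → refl_ a (refl_ b (refl_ a v)) ≈ᵥ refl_ (refl_ a b) v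
    refl-conj b v = begin
        refl_ a (refl_ b (refl_ a v))
      ≈⟨ IsLinear.-ᵥ-homo (refl-isLinear a) (refl_ a v) (cartan (refl_ a v) b ·ᵥ b) ⟩
        refl_ a (refl_ a v) -ᵥ refl_ a (cartan (refl_ a v) b ·ᵥ b)
      ≈⟨ (λ i → cong (λ t → refl_ a (refl_ a v) i - t) (IsLinear.·-homo (refl-isLinear a) (cartan (refl_ a v) b) b i)) ⟩
        refl_ a (refl_ a v) -ᵥ (cartan (refl_ a v) b ·ᵥ refl_ a b)
      ≈⟨ (λ i → cong₂ (λ x t → x - t * refl_ a b i) (refl-involutive v i) cartan-transport) ⟩
        refl_ (refl_ a b) v ∎
      where
      open ≈ᵥ-Reasoning N
      cartan-transport : cartan (refl_ a v) b ≡ cartan v (refl_ a b)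
      cartan-transport = cong₂ (λ x y → (two * x) * inv y)
        (trans (sym (refl-isometry (refl_ a v) b)) (⟪⟫-cong (refl-involutive v) ≋-refl))
        (sym (refl-isometry b b))

basis : ∀ {n} → Fin n → Vecℚ n
basis i j = ℕtoℚ (δ i j)

minus-scaled-basis-off : ∀ {n} (c : Vecℚ n) t {i k : Fin n} → i ≢ k → (c -ᵥ (t ·ᵥ basis i)) k ≡ c k
minus-scaled-basis-off c t {i} {k} i≢k = begin
  c k - t * ℕtoℚ (δ i k)  ≡⟨ cong (λ n → c k - t * ℕtoℚ n) (δ-off i≢k) ⟩
  c k - t * 0ℚ            ≡⟨ solve 2 (λ x t → x :- t :* con 0ℚ := x) refl (c k) t ⟩
  c k                     ∎
  where open ≡-Reasoning

module _ {N m : ℕ} (G : Fin m → Vecℚ N) where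

  lin-isLinear : IsLinear (lin G)
  lin-isLinear = record
    { cong-≈ = λ c≈c' i → ∑-cong (λ j → cong (_* G j i) (c≈c' j))
    ; +-homo = λ c d i → trans (∑-cong (λ j → *-distribʳ-+ (G j i) (c j) (d j))) (∑-distrib-+ {m} _ _)
    ; ·-homo = λ t c i → trans (∑-cong (λ j → *-assoc t (c j) (G j i))) (∑-*ˡ {m} t _)
    }

  lin-basis : (k : Fin m) → lin G (basis k) ≈ᵥ G k
  lin-basis k i = ∑-δ k (λ j → G j i)

  lin-single : (c : Fin m → ℚ) (i : Fin m) → (∀ j → i ≢ j → c j ≡ 0ℚ) → lin G c ≈ᵥ (c i ·ᵥ G i)
  lin-single c i off = begin
      lin G c
    ≈⟨ IsLinear.cong-≈ lin-isLinear c≈ci·basis ⟩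
      lin G (c i ·ᵥ basis i)
    ≈⟨ IsLinear.·-homo lin-isLinear (c i) (basis i) ⟩
      c i ·ᵥ lin G (basis i)
    ≈⟨ (λ k → cong (c i *_) (lin-basis i k)) ⟩
      c i ·ᵥ G i ∎
    where
    open ≈ᵥ-Reasoning N
    c≈ci·basis : c ≈ᵥ (c i ·ᵥ basis i)
    c≈ci·basis j with i Fin.≟ j
    ... | yes refl = trans (sym (*-identityʳ (c i))) (cong (λ n → c i * ℕtoℚ n) (sym (δ-diag i)))
    ... | no  i≢j  = trans (off j i≢j) (trans (sym (*-zeroʳ (c i))) (cong (λ n → c i * ℕtoℚ n) (sym (δ-off i≢j))))

All-reverse : ∀ {A : Set} {P : A → Set} {xs : List A} → All P xs → All P (reverse xs)
All-reverse {xs = []}     []         = []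
All-reverse {xs = x ∷ xs} (px ∷ pxs) = subst (All _) (sym (List.unfold-reverse x xs)) (All.∷ʳ⁺ (All-reverse pxs) px)

module Words {N r : ℕ} (Π : Fin r → Vecℚ N) where

  act-isLinear : ∀ w → IsLinear (act Π w)
  act-isLinear []      = idᵥ-isLinear
  act-isLinear (i ∷ w) = ∘-isLinear (refl-isLinear (Π i)) (act-isLinear w)

  act-cong : ∀ w {u v} → u ≈ᵥ v → act Π w u ≈ᵥ act Π w v
  act-cong w = IsLinear.cong-≈ (act-isLinear w)

  act-snoc : ∀ w i v → act Π (w ∷ʳ i) v ≡ act Π w (refl_ (Π i) v)
  act-snoc []      i v = refl
  act-snoc (k ∷ w) i v = cong (refl_ (Π k)) (act-snoc w i v)

  act-reverse-∷ : ∀ i w v → act Π (reverse (i ∷ w)) v ≡ act Π (reverse w) (refl_ (Π i) v)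
  act-reverse-∷ i w v = trans (cong (λ u → act Π u v) (List.unfold-reverse i w)) (act-snoc (reverse w) i v)

  module Inverses (Π≉0 : ∀ i → ¬ Π i ≈ᵥ 0ᵥ) where

    s-involutive : ∀ i v → refl_ (Π i) (refl_ (Π i) v) ≈ᵥ v
    s-involutive i = Reflection.refl-involutive (Π i) (Π≉0 i)

    act-reverse-inverseˡ : ∀ w v → act Π (reverse w) (act Π w v) ≈ᵥ v
    act-reverse-inverseˡ []      v = ≋-refl
    act-reverse-inverseˡ (i ∷ w) v = begin
        act Π (reverse (i ∷ w)) (refl_ (Π i) (act Π w v))
      ≡⟨ act-reverse-∷ i w _ ⟩
        act Π (reverse w) (refl_ (Π i) (refl_ (Π i) (act Π w v)))
      ≈⟨ act-cong (reverse w) (s-involutive i (act Π w v)) ⟩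
        act Π (reverse w) (act Π w v)
      ≈⟨ act-reverse-inverseˡ w v ⟩
        v ∎
      where open ≈ᵥ-Reasoning N

    act-reverse-inverseʳ : ∀ w v → act Π w (act Π (reverse w) v) ≈ᵥ v
    act-reverse-inverseʳ []      v = ≋-refl
    act-reverse-inverseʳ (i ∷ w) v = begin
        refl_ (Π i) (act Π w (act Π (reverse (i ∷ w)) v))
      ≡⟨ cong (refl_ (Π i) ∘ act Π w) (act-reverse-∷ i w v) ⟩
        refl_ (Π i) (act Π w (act Π (reverse w) (refl_ (Π i) v)))
      ≈⟨ refl-cong ≋-refl (act-reverse-inverseʳ w (refl_ (Π i) v)) ⟩
        refl_ (Π i) (refl_ (Π i) v)
      ≈⟨ s-involutive i v ⟩
        v ∎
      where open ≈ᵥ-Reasoning N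

    act-injective : ∀ w {u v} → act Π w u ≈ᵥ act Π w v → u ≈ᵥ v
    act-injective w {u} {v} wu≈wv = begin
      u                              ≈˘⟨ act-reverse-inverseˡ w u ⟩
      act Π (reverse w) (act Π w u)  ≈⟨ act-cong (reverse w) wu≈wv ⟩
      act Π (reverse w) (act Π w v)  ≈⟨ act-reverse-inverseˡ w v ⟩
      v                              ∎
      where open ≈ᵥ-Reasoning N

    act-conj : ∀ u a v → act Π u (refl_ a (act Π (reverse u) v)) ≈ᵥ refl_ (act Π u a) v
    act-conj []      a v = ≋-refl
    act-conj (i ∷ u) a v = begin
        refl_ (Π i) (act Π u (refl_ a (act Π (reverse (i ∷ u)) v)))
      ≡⟨ cong (λ x → refl_ (Π i) (act Π u (refl_ a x))) (act-reverse-∷ i u v) ⟩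
        refl_ (Π i) (act Π u (refl_ a (act Π (reverse u) (refl_ (Π i) v))))
      ≈⟨ refl-cong ≋-refl (act-conj u a (refl_ (Π i) v)) ⟩
        refl_ (Π i) (refl_ (act Π u a) (refl_ (Π i) v))
      ≈⟨ Reflection.refl-conj (Π i) (Π≉0 i) (act Π u a) v ⟩
        refl_ (act Π (i ∷ u) a) v ∎
      where open ≈ᵥ-Reasoning N

    SameElt-reverse : ∀ u w → SameElt Π u w → SameElt Π (reverse u) (reverse w)
    SameElt-reverse u w u≡w v = begin
        act Π (reverse u) v
      ≈˘⟨ act-cong (reverse u) (act-reverse-inverseʳ w v) ⟩
        act Π (reverse u) (act Π w (act Π (reverse w) v))
      ≈˘⟨ act-cong (reverse u) (u≡w (act Π (reverse w) v)) ⟩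
        act Π (reverse u) (act Π u (act Π (reverse w) v))
      ≈⟨ act-reverse-inverseˡ u _ ⟩
        act Π (reverse w) v ∎
      where open ≈ᵥ-Reasoning N

    IsLongestParabolic-reverse : ∀ {S w} → IsLongestParabolic Π S w → IsLongestParabolic Π S (reverse w)
    IsLongestParabolic-reverse {S} {w} (w∈W , L , ((u , |u|≤L , w≡u) , L≤) , longest) =
      All-reverse w∈W , L ,
      ((reverse u , subst (ℕ._≤ L) (sym (List.length-reverse u)) |u|≤L , SameElt-reverse w u w≡u) , L≤′) ,
      longest
      where
      L≤′ : ∀ u → SameElt Π (reverse w) u → L ℕ.≤ length u
      L≤′ u w⁻¹≡u = subst (L ℕ.≤_) (List.length-reverse u)
        (L≤ (reverse u) (subst (λ x → SameElt Π x (reverse u)) (List.reverse-involutive w)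
                               (SameElt-reverse (reverse w) u w⁻¹≡u)))

module RootSystem {N r : ℕ} (Φ : List (Vecℚ N)) (rs : IsRootSystem Φ)
                  (Π : Fin r → Vecℚ N) (ss : IsSimpleSystem Φ Π) where

  open IsRootSystem rs
  open IsSimpleSystem ss

  Π≉0 : ∀ i → ¬ Π i ≈ᵥ 0ᵥ
  Π≉0 i = nonzero (Π i) (inΦ i)

  open Words Π public
  open Inverses Π≉0 public

  ∈Φ-resp : ∀ {β β'} → β ≈ᵥ β' → β ∈Φ Φ → β' ∈Φ Φ
  ∈Φ-resp β≈β' = Any.map (≋-trans (≋-sym β≈β'))

  act-∈Φ : ∀ w {β} → β ∈Φ Φ → act Π w β ∈Φ Φ
  act-∈Φ []      β∈Φ = β∈Φ
  act-∈Φ (i ∷ w) β∈Φ = reflClosed (Π i) _ (inΦ i) (act-∈Φ w β∈Φ)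

  coefficients-unique : ∀ c c' → lin Π c ≈ᵥ lin Π c' → ∀ i → c i ≡ c' i
  coefficients-unique c c' c≈c' i = begin
      c i                  ≡⟨ solve 2 (λ x y → x := (x :- y) :+ y) refl (c i) (c' i) ⟩
      (c i - c' i) + c' i  ≡⟨ cong (_+ c' i) (linIndep (c -ᵥ c') lin[c-c']≈0 i) ⟩
      0ℚ + c' i            ≡⟨ +-identityˡ (c' i) ⟩
      c' i                 ∎
    where
    open ≡-Reasoning
    lin[c-c']≈0 : lin Π (c -ᵥ c') ≈ᵥ 0ᵥ
    lin[c-c']≈0 k = trans (IsLinear.-ᵥ-homo (lin-isLinear Π) c c' k)
                          (trans (cong (_- lin Π c' k) (c≈c' k)) (+-inverseʳ (lin Π c' k)))

  Positive Negative : Vecℚ N → Set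
  Positive β = Σ (Fin r → ℚ) λ c → β ≈ᵥ lin Π c × (∀ i → 0ℚ ≤ c i)
  Negative β = Σ (Fin r → ℚ) λ c → β ≈ᵥ lin Π c × (∀ i → c i ≤ 0ℚ)

  Negative-resp : ∀ {β β'} → β ≈ᵥ β' → Negative β → Negative β'
  Negative-resp β≈β' (c , β≈c , c≤0) = c , ≋-trans (≋-sym β≈β') β≈c , c≤0

  positive⊎negative : ∀ {β} → β ∈Φ Φ → Positive β ⊎ Negative β
  positive⊎negative {β} β∈Φ with sameSign β β∈Φ
  ... | c , β≈c , inj₁ 0≤c = inj₁ (c , β≈c , 0≤c)
  ... | c , β≈c , inj₂ c≤0 = inj₂ (c , β≈c , c≤0)

  ¬positive∧negative : ∀ {β} → β ∈Φ Φ → Positive β → Negative β → ⊥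
  ¬positive∧negative {β} β∈Φ (c , β≈c , 0≤c) (d , β≈d , d≤0) = nonzero β β∈Φ (begin
      β           ≈⟨ β≈c ⟩
      lin Π c     ≈⟨ IsLinear.cong-≈ (lin-isLinear Π) c≈0 ⟩
      lin Π 0ᵥ    ≈⟨ IsLinear.0-homo (lin-isLinear Π) ⟩
      0ᵥ          ∎)
    where
    open ≈ᵥ-Reasoning N
    c≈0 : c ≈ᵥ 0ᵥ
    c≈0 j = ≤-antisym (subst (_≤ 0ℚ) (sym (coefficients-unique c d (≋-trans (≋-sym β≈c) β≈d) j)) (d≤0 j))
                      (0≤c j)

  simple-positive : ∀ j → Positive (Π j)
  simple-positive j = basis j , ≋-sym (lin-basis Π j) , λ k → ℕtoℚ-nonNeg (δ j k)

  positive⇒negated-negative : ∀ {β} → Positive β → Negative (-ᵥ β)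
  positive⇒negated-negative (c , β≈c , 0≤c) =
    (-ᵥ c) , ≋-trans (IsLinear.cong-≈ neg-isLinear β≈c) (≋-sym (IsLinear.-‿homo (lin-isLinear Π) c)) ,
    λ j → neg-antimono-≤ (0≤c j)

  s-coefficients : ∀ i {β} c → β ≈ᵥ lin Π c → refl_ (Π i) β ≈ᵥ lin Π (c -ᵥ (cartan β (Π i) ·ᵥ basis i))
  s-coefficients i {β} c β≈c = begin
      β -ᵥ (t ·ᵥ Π i)
    ≈⟨ (λ k → cong₂ (λ x y → x - t * y) (β≈c k) (sym (lin-basis Π i k))) ⟩
      lin Π c -ᵥ (t ·ᵥ lin Π (basis i))
    ≈˘⟨ (λ k → cong (λ x → lin Π c k - x) (IsLinear.·-homo (lin-isLinear Π) t (basis i) k)) ⟩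
      lin Π c -ᵥ lin Π (t ·ᵥ basis i)
    ≈˘⟨ IsLinear.-ᵥ-homo (lin-isLinear Π) c (t ·ᵥ basis i) ⟩
      lin Π (c -ᵥ (t ·ᵥ basis i)) ∎
    where
    open ≈ᵥ-Reasoning N
    t : ℚ
    t = cartan β (Π i)

  -- s_i changes only the α_i-coordinate, so a positive root it makes negative is a multiple of α_i.
  s-negative⇒simple : ∀ i {β} → β ∈Φ Φ → Positive β → Negative (refl_ (Π i) β) → β ≈ᵥ Π i
  s-negative⇒simple i {β} β∈Φ (c , β≈c , 0≤c) (d , sβ≈d , d≤0) =
    unit-multiple (multiples (Π i) (c i) (inΦ i) (∈Φ-resp β≈ci·αi β∈Φ))
    where
    t : ℚ
    t = cartan β (Π i)
    c≡0-off-i : ∀ j → i ≢ j → c j ≡ 0ℚ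
    c≡0-off-i j i≢j = ≤-antisym (subst (_≤ 0ℚ) dj≡cj (d≤0 j)) (0≤c j)
      where
      dj≡cj : d j ≡ c j
      dj≡cj = trans (sym (coefficients-unique (c -ᵥ (t ·ᵥ basis i)) d
                                              (≋-trans (≋-sym (s-coefficients i c β≈c)) sβ≈d) j))
                    (minus-scaled-basis-off c t i≢j)
    β≈ci·αi : β ≈ᵥ (c i ·ᵥ Π i)
    β≈ci·αi = ≋-trans β≈c (lin-single Π c i c≡0-off-i)
    unit-multiple : (c i ≡ 1ℚ) ⊎ (c i ≡ - 1ℚ) → β ≈ᵥ Π i
    unit-multiple (inj₁ ci≡1)  = ≋-trans β≈ci·αi (λ k → trans (cong (_* Π i k) ci≡1) (*-identityˡ (Π i k)))
    unit-multiple (inj₂ ci≡-1) = ⊥-elim (0≰-1 (subst (0ℚ ≤_) ci≡-1 (0≤c i)))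

  -- If u = s_i u₀ is the first prefix turning α_j negative, then u₀ α_j = α_i, so s_i u₀ s_j = u₀.
  exchange-condition : ∀ u j → Negative (act Π u (Π j)) →
                       ∃[ u' ] (suc (length u') ≡ length u × SameElt Π (u ∷ʳ j) u')
  exchange-condition []      j neg = ⊥-elim (¬positive∧negative (inΦ j) (simple-positive j) neg)
  exchange-condition (i ∷ u) j neg with positive⊎negative (act-∈Φ u (inΦ j))
  ... | inj₂ neg′ with exchange-condition u j neg′
  ...   | u' , |u'|+1≡|u| , usj≡u' = i ∷ u' , cong suc |u'|+1≡|u| , λ v → refl-cong ≋-refl (usj≡u' v)
  exchange-condition (i ∷ u) j neg | inj₁ pos = u , refl , λ v → begin
      refl_ (Π i) (act Π (u ∷ʳ j) v)
    ≡⟨ cong (refl_ (Π i)) (act-snoc u j v) ⟩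
      refl_ (Π i) (act Π u (refl_ (Π j) v))
    ≈˘⟨ refl-cong ≋-refl (act-cong u (refl-cong ≋-refl (act-reverse-inverseˡ u v))) ⟩
      refl_ (Π i) (act Π u (refl_ (Π j) (act Π (reverse u) (act Π u v))))
    ≈⟨ refl-cong ≋-refl (act-conj u (Π j) (act Π u v)) ⟩
      refl_ (Π i) (refl_ (act Π u (Π j)) (act Π u v))
    ≈⟨ refl-cong ≋-refl (refl-cong {u = act Π u v} (s-negative⇒simple i (act-∈Φ u (inΦ j)) pos neg) ≋-refl) ⟩
      refl_ (Π i) (refl_ (Π i) (act Π u v))
    ≈⟨ s-involutive i (act Π u v) ⟩
      act Π u v ∎
    where open ≈ᵥ-Reasoning N

  SameElt-snoc : ∀ w j u → SameElt Π (w ∷ʳ j) u → SameElt Π w (u ∷ʳ j)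
  SameElt-snoc w j u wsj≡u v = begin
      act Π w v                         ≈˘⟨ act-cong w (s-involutive j v) ⟩
      act Π w (refl_ (Π j) (refl_ (Π j) v)) ≡˘⟨ act-snoc w j (refl_ (Π j) v) ⟩
      act Π (w ∷ʳ j) (refl_ (Π j) v)    ≈⟨ wsj≡u (refl_ (Π j) v) ⟩
      act Π u (refl_ (Π j) v)           ≡˘⟨ act-snoc u j v ⟩
      act Π (u ∷ʳ j) v                  ∎
    where open ≈ᵥ-Reasoning N

  snoc-simple : ∀ w j → act Π (w ∷ʳ j) (Π j) ≈ᵥ (-ᵥ act Π w (Π j))
  snoc-simple w j = begin
      act Π (w ∷ʳ j) (Π j)         ≡⟨ act-snoc w j (Π j) ⟩
      act Π w (refl_ (Π j) (Π j))  ≈⟨ act-cong w (Reflection.refl-self (Π j) (Π≉0 j)) ⟩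
      act Π w (-ᵥ Π j)             ≈⟨ IsLinear.-‿homo (act-isLinear w) (Π j) ⟩
      -ᵥ act Π w (Π j)             ∎
    where open ≈ᵥ-Reasoning N

  -- Otherwise w s_j would be an element of W_{Π∖S} strictly longer than w.
  longestParabolic-simple-negative : ∀ {S w} → IsLongestParabolic Π S w → ∀ j → j ∉ S → Negative (act Π w (Π j))
  longestParabolic-simple-negative {S} {w} (w∈W , L , (_ , L≤) , longest) j j∉S
    with positive⊎negative (act-∈Φ w (inΦ j))
  ... | inj₂ neg = neg
  ... | inj₁ pos = ⊥-elim (w∷ʳj-too-long (longest (w ∷ʳ j) (All.∷ʳ⁺ w∈W j∉S)))
    where
    w∷ʳj-too-long : LengthAtMost Π (w ∷ʳ j) L → ⊥
    w∷ʳj-too-long (u , |u|≤L , wsj≡u) = shorter (exchange-condition u j u-negates)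
      where
      u-negates : Negative (act Π u (Π j))
      u-negates = Negative-resp {β = -ᵥ act Π w (Π j)} (≋-trans (≋-sym (snoc-simple w j)) (wsj≡u (Π j)))
                                (positive⇒negated-negative pos)
      shorter : ∃[ u' ] (suc (length u') ≡ length u × SameElt Π (u ∷ʳ j) u') → ⊥
      shorter (u' , |u'|+1≡|u| , usj≡u') =
        ℕ.<-irrefl refl (ℕ.≤-trans (ℕ.≤-trans (ℕ.≤-reflexive |u'|+1≡|u|) |u|≤L)
                                   (L≤ u' (λ v → ≋-trans (SameElt-snoc w j u wsj≡u v) (usj≡u' v))))

  ℤComb : Vecℚ N → Set
  ℤComb v = Σ (Fin r → ℤ) λ z → v ≈ᵥ lin Π (fromℤ ∘ z)

  s-ℤComb : ∀ i {β} → β ∈Φ Φ → ℤComb β → ℤComb (refl_ (Π i) β)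
  s-ℤComb i {β} β∈Φ (z , β≈z) with crystallographic (Π i) β (inΦ i) β∈Φ
  ... | m , t≡m = z′ , ≋-trans (s-coefficients i (fromℤ ∘ z) β≈z) (IsLinear.cong-≈ (lin-isLinear Π) coefficients)
    where
    z′ : Fin r → ℤ
    z′ k = z k ℤ.- m ℤ.* ℤ.+ δ i k
    coefficients : ((fromℤ ∘ z) -ᵥ (cartan β (Π i) ·ᵥ basis i)) ≈ᵥ (fromℤ ∘ z′)
    coefficients k = begin
        fromℤ (z k) - cartan β (Π i) * ℕtoℚ (δ i k)   ≡⟨ cong (λ t → fromℤ (z k) - t * ℕtoℚ (δ i k)) t≡m ⟩
        fromℤ (z k) - fromℤ m * fromℤ (ℤ.+ δ i k)      ≡˘⟨ cong (λ x → fromℤ (z k) - x) (fromℤ-* m (ℤ.+ δ i k)) ⟩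
        fromℤ (z k) - fromℤ (m ℤ.* ℤ.+ δ i k)          ≡˘⟨ cong (fromℤ (z k) +_) (fromℤ-neg (m ℤ.* ℤ.+ δ i k)) ⟩
        fromℤ (z k) + fromℤ (ℤ.- (m ℤ.* ℤ.+ δ i k))    ≡˘⟨ fromℤ-+ (z k) (ℤ.- (m ℤ.* ℤ.+ δ i k)) ⟩
        fromℤ (z′ k)                                   ∎
      where open ≡-Reasoning

  act-ℤComb : ∀ w {β} → β ∈Φ Φ → ℤComb β → ℤComb (act Π w β)
  act-ℤComb []      β∈Φ β∈ℤΠ = β∈ℤΠ
  act-ℤComb (i ∷ w) β∈Φ β∈ℤΠ = s-ℤComb i (act-∈Φ w β∈Φ) (act-ℤComb w β∈Φ β∈ℤΠ)

  simple-ℤComb : ∀ j → ℤComb (Π j)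
  simple-ℤComb j = (λ k → ℤ.+ δ j k) , ≋-sym (lin-basis Π j)

  -- x ≼[ Π ] y unfolds to ℕComb (y -ᵥ x).
  ℕComb : Vecℚ N → Set
  ℕComb v = Σ (Fin r → ℕ) λ k → v ≈ᵥ lin Π (ℕtoℚ ∘ k)

  ℕComb-resp : ∀ {u v} → u ≈ᵥ v → ℕComb u → ℕComb v
  ℕComb-resp u≈v (k , u≈k) = k , ≋-trans (≋-sym u≈v) u≈k

  ℕComb-zero : ℕComb 0ᵥ
  ℕComb-zero = (λ _ → 0) , ≋-sym (IsLinear.0-homo (lin-isLinear Π))

  ℕComb-+ : ∀ {u v} → ℕComb u → ℕComb v → ℕComb (u +ᵥ v)
  ℕComb-+ {u} {v} (k , u≈k) (l , v≈l) = (λ j → k j ℕ.+ l j) , (begin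
      u +ᵥ v                                ≈⟨ (λ i → cong₂ _+_ (u≈k i) (v≈l i)) ⟩
      lin Π (ℕtoℚ ∘ k) +ᵥ lin Π (ℕtoℚ ∘ l)  ≈˘⟨ IsLinear.+-homo (lin-isLinear Π) (ℕtoℚ ∘ k) (ℕtoℚ ∘ l) ⟩
      lin Π ((ℕtoℚ ∘ k) +ᵥ (ℕtoℚ ∘ l))      ≈˘⟨ IsLinear.cong-≈ (lin-isLinear Π) (λ j → ℕtoℚ-+ (k j) (l j)) ⟩
      lin Π (λ j → ℕtoℚ (k j ℕ.+ l j))      ∎)
    where open ≈ᵥ-Reasoning N

  ℕComb-* : ∀ n {v} → ℕComb v → ℕComb (ℕtoℚ n ·ᵥ v)
  ℕComb-* n {v} (k , v≈k) = (λ j → n ℕ.* k j) , (begin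
      ℕtoℚ n ·ᵥ v                  ≈⟨ (λ i → cong (ℕtoℚ n *_) (v≈k i)) ⟩
      ℕtoℚ n ·ᵥ lin Π (ℕtoℚ ∘ k)   ≈˘⟨ IsLinear.·-homo (lin-isLinear Π) (ℕtoℚ n) (ℕtoℚ ∘ k) ⟩
      lin Π (ℕtoℚ n ·ᵥ (ℕtoℚ ∘ k)) ≈˘⟨ IsLinear.cong-≈ (lin-isLinear Π) (λ j → ℕtoℚ-* n (k j)) ⟩
      lin Π (λ j → ℕtoℚ (n ℕ.* k j)) ∎)
    where open ≈ᵥ-Reasoning N

  ℕComb-lin : ∀ {m} (G : Fin m → Vecℚ N) (k : Fin m → ℕ) →
              (∀ j → k j ≡ 0 ⊎ ℕComb (G j)) → ℕComb (lin G (ℕtoℚ ∘ k))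
  ℕComb-lin {zero}  G k _   = ℕComb-zero
  ℕComb-lin {suc m} G k hyp = ℕComb-+ (first-term (hyp zero)) (ℕComb-lin (G ∘ suc) (k ∘ suc) (hyp ∘ suc))
    where
    first-term : k zero ≡ 0 ⊎ ℕComb (G zero) → ℕComb (ℕtoℚ (k zero) ·ᵥ G zero)
    first-term (inj₁ k₀≡0) = ℕComb-resp (λ i → trans (sym (*-zeroˡ (G zero i)))
                                                     (cong (λ n → ℕtoℚ n * G zero i) (sym k₀≡0)))
                                        ℕComb-zero
    first-term (inj₂ G₀∈ℕ) = ℕComb-* (k zero) G₀∈ℕ

  ℕComb-antisym : ∀ {v} → ℕComb v → ℕComb (-ᵥ v) → v ≈ᵥ 0ᵥ
  ℕComb-antisym {v} (k , v≈k) (k' , -v≈k') = begin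
      v                  ≈⟨ v≈k ⟩
      lin Π (ℕtoℚ ∘ k)   ≈⟨ IsLinear.cong-≈ (lin-isLinear Π) (λ j → cong ℕtoℚ (k≡0 j)) ⟩
      lin Π 0ᵥ           ≈⟨ IsLinear.0-homo (lin-isLinear Π) ⟩
      0ᵥ                 ∎
    where
    open ≈ᵥ-Reasoning N
    k+k'≡0 : ∀ j → ℕtoℚ (k j ℕ.+ k' j) ≡ 0ℚ
    k+k'≡0 = linIndep _ (λ i → trans (sym (proj₂ (ℕComb-+ (k , v≈k) (k' , -v≈k')) i)) (+-inverseʳ (v i)))
    k≡0 : ∀ j → k j ≡ 0
    k≡0 j = ℕ.m+n≡0⇒m≡0 (k j) (ℕtoℚ≡0⇒≡0 _ (k+k'≡0 j))

  negative-ℤComb⇒negated-ℕComb : ∀ {v} → Negative v → ℤComb v → ℕComb (-ᵥ v)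
  negative-ℤComb⇒negated-ℕComb {v} (c , v≈c , c≤0) (z , v≈z) = (λ k → ℤ.∣ z k ∣) , (begin
      -ᵥ v                                   ≈⟨ IsLinear.cong-≈ neg-isLinear v≈z ⟩
      -ᵥ lin Π (fromℤ ∘ z)                   ≈⟨ IsLinear.cong-≈ neg-isLinear (IsLinear.cong-≈ (lin-isLinear Π) z≡-∣z∣) ⟩
      -ᵥ lin Π (-ᵥ (λ k → ℕtoℚ ℤ.∣ z k ∣))    ≈⟨ IsLinear.cong-≈ neg-isLinear (IsLinear.-‿homo (lin-isLinear Π) (λ k → ℕtoℚ ℤ.∣ z k ∣)) ⟩
      -ᵥ (-ᵥ lin Π (λ k → ℕtoℚ ℤ.∣ z k ∣))    ≈⟨ (λ i → solve 1 (λ x → :- (:- x) := x) refl (lin Π (λ k → ℕtoℚ ℤ.∣ z k ∣) i)) ⟩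
      lin Π (λ k → ℕtoℚ ℤ.∣ z k ∣)            ∎)
    where
    open ≈ᵥ-Reasoning N
    z≡-∣z∣ : ∀ k → fromℤ (z k) ≡ - ℕtoℚ ℤ.∣ z k ∣
    z≡-∣z∣ k = fromℤ-nonPos (z k)
      (subst (_≤ 0ℚ) (sym (coefficients-unique (fromℤ ∘ z) c (≋-trans (≋-sym v≈z) v≈c) k)) (c≤0 k))

  longestParabolic-simple-negℕComb : ∀ {S w} → IsLongestParabolic Π S w → ∀ j → j ∉ S → ℕComb (-ᵥ act Π w (Π j))
  longestParabolic-simple-negℕComb {w = w} w-longest j j∉S =
    negative-ℤComb⇒negated-ℕComb (longestParabolic-simple-negative w-longest j j∉S)
                            (act-ℤComb w (inΦ j) (simple-ℤComb j))

  ≼-resp : ∀ {x x' y y'} → x ≈ᵥ x' → y ≈ᵥ y' → x ≼[ Π ] y → x' ≼[ Π ] y'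
  ≼-resp x≈x' y≈y' = ℕComb-resp (λ i → cong₂ _-_ (y≈y' i) (x≈x' i))

  ≼-antisym : ∀ {x y} → x ≼[ Π ] y → y ≼[ Π ] x → x ≈ᵥ y
  ≼-antisym {x} {y} x≼y y≼x i = begin
      x i                ≡⟨ solve 2 (λ x y → x := y :- (y :- x)) refl (x i) (y i) ⟩
      y i - (y i - x i)  ≡⟨ cong (λ d → y i - d) (ℕComb-antisym x≼y (ℕComb-resp -[y-x]≈x-y y≼x) i) ⟩
      y i - 0ℚ           ≡⟨ solve 1 (λ y → y :- con 0ℚ := y) refl (y i) ⟩
      y i                ∎
    where
    open ≡-Reasoning
    -[y-x]≈x-y : (x -ᵥ y) ≈ᵥ (-ᵥ (y -ᵥ x))
    -[y-x]≈x-y j = solve 2 (λ x y → x :- y := :- (y :- x)) refl (x j) (y j)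

  module Face (θ : Vecℚ N) (S : Subset r) where

    InF : Vecℚ N → Set
    InF = InIF Φ Π θ S

    s-InF : ∀ i {β} → i ∉ S → InF β → InF (refl_ (Π i) β)
    s-InF i {β} i∉S (β∈Φ , c , d , β≈c , θ≈d , c≡d) =
      reflClosed (Π i) β (inΦ i) β∈Φ , c -ᵥ (t ·ᵥ basis i) , d , s-coefficients i c β≈c , θ≈d ,
      λ k k∈S → trans (minus-scaled-basis-off c t (λ i≡k → i∉S (subst (_∈ S) (sym i≡k) k∈S))) (c≡d k k∈S)
      where
      t : ℚ
      t = cartan β (Π i)

    act-InF : ∀ w → InParabolic S w → ∀ {β} → InF β → InF (act Π w β)
    act-InF []      []             β∈F = β∈F
    act-InF (i ∷ w) (i∉S ∷ w∈W) β∈F = s-InF i i∉S (act-InF w w∈W β∈F)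

    -- Both members have the S-coordinates of θ.
    InF-difference : ∀ {β γ} → InF β → InF γ → ∀ k → (γ -ᵥ β) ≈ᵥ lin Π (ℕtoℚ ∘ k) → ∀ j → j ∈ S → k j ≡ 0
    InF-difference {β} {γ} (_ , c , d , β≈c , θ≈d , c≡d) (_ , c' , d' , γ≈c' , θ≈d' , c'≡d') k γ-β≈k j j∈S =
      ℕtoℚ≡0⇒≡0 (k j) (begin
        ℕtoℚ (k j)   ≡⟨ coefficients-unique (ℕtoℚ ∘ k) (c' -ᵥ c) (≋-trans (≋-sym γ-β≈k) γ-β≈c'-c) j ⟩
        c' j - c j   ≡⟨ cong₂ _-_ (trans (c'≡d' j j∈S) (sym dj≡d'j)) (c≡d j j∈S) ⟩
        d j - d j    ≡⟨ +-inverseʳ (d j) ⟩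
        0ℚ           ∎)
      where
      open ≡-Reasoning
      dj≡d'j : d j ≡ d' j
      dj≡d'j = coefficients-unique d d' (≋-trans (≋-sym θ≈d) θ≈d') j
      γ-β≈c'-c : (γ -ᵥ β) ≈ᵥ lin Π (c' -ᵥ c)
      γ-β≈c'-c i = trans (cong₂ _-_ (γ≈c' i) (β≈c i)) (sym (IsLinear.-ᵥ-homo (lin-isLinear Π) c' c i))

    longestParabolic-antitone : ∀ {w} → IsLongestParabolic Π S w → ∀ {β γ} → InF β → InF γ →
                                β ≼[ Π ] γ → act Π w γ ≼[ Π ] act Π w β
    longestParabolic-antitone {w} w-longest {β} {γ} β∈F γ∈F (k , γ-β≈k) =
      ℕComb-resp (≋-sym wβ-wγ≈) (ℕComb-lin (λ j → -ᵥ act Π w (Π j)) k off-S-negated)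
      where
      open ≈ᵥ-Reasoning N
      -w : IsLinear (λ v → -ᵥ act Π w v)
      -w = ∘-isLinear neg-isLinear (act-isLinear w)
      wβ-wγ≈ : (act Π w β -ᵥ act Π w γ) ≈ᵥ lin (λ j → -ᵥ act Π w (Π j)) (ℕtoℚ ∘ k)
      wβ-wγ≈ = begin
          act Π w β -ᵥ act Π w γ      ≈⟨ (λ i → solve 2 (λ x y → x :- y := :- (y :- x)) refl (act Π w β i) (act Π w γ i)) ⟩
          -ᵥ (act Π w γ -ᵥ act Π w β) ≈˘⟨ IsLinear.cong-≈ neg-isLinear (IsLinear.-ᵥ-homo (act-isLinear w) γ β) ⟩
          -ᵥ act Π w (γ -ᵥ β)         ≈⟨ IsLinear.cong-≈ -w γ-β≈k ⟩
          -ᵥ act Π w (lin Π (ℕtoℚ ∘ k)) ≈⟨ IsLinear.lin-homo -w Π (ℕtoℚ ∘ k) ⟩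
          lin (λ j → -ᵥ act Π w (Π j)) (ℕtoℚ ∘ k) ∎
      off-S-negated : ∀ j → k j ≡ 0 ⊎ ℕComb (-ᵥ act Π w (Π j))
      off-S-negated j with j ∈? S
      ... | yes j∈S = inj₁ (InF-difference β∈F γ∈F k γ-β≈k j j∈S)
      ... | no  j∉S = inj₂ (longestParabolic-simple-negℕComb w-longest j j∉S)

    module _ (θ-highest : IsHighestRoot Φ Π θ) where

      θ-InF : InF θ
      θ-InF with sameSign θ (proj₁ θ-highest)
      ... | d , θ≈d , _ = proj₁ θ-highest , d , d , θ≈d , θ≈d , λ _ _ → refl

      -- w θ is below w (w⁻¹ β) = β, as w reverses w⁻¹ β ≤ θ.
      longestParabolic-θ-least : ∀ {w} → IsLongestParabolic Π S w → ∀ {β} → InF β → act Π w θ ≼[ Π ] β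
      longestParabolic-θ-least {w} w-longest {β} β∈F =
        ≼-resp ≋-refl (act-reverse-inverseʳ w β)
          (longestParabolic-antitone w-longest w⁻¹β∈F θ-InF (proj₂ θ-highest _ (proj₁ w⁻¹β∈F)))
        where
        w⁻¹β∈F : InF (act Π (reverse w) β)
        w⁻¹β∈F = act-InF (reverse w) (All-reverse (proj₁ w-longest)) β∈F

proposition2p7 : (N r : ℕ) (Φ : List (Vecℚ N)) → IsRootSystem Φ → Irreducible Φ →
    (Π : Fin r → Vecℚ N) → IsSimpleSystem Φ Π →
    (θ : Vecℚ N) → IsHighestRoot Φ Π θ →
    (S : Subset r) (w : List (Fin r)) → IsLongestParabolic Π S w →
    -- w maps I_{F_S} into itself
    (∀ β → InIF Φ Π θ S β → InIF Φ Π θ S (act Π w β))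
    -- onto
    × (∀ γ → InIF Φ Π θ S γ → ∃[ β ] (InIF Φ Π θ S β × act Π w β ≈ᵥ γ))
    -- injective
    × (∀ β γ → InIF Φ Π θ S β → InIF Φ Π θ S γ → act Π w β ≈ᵥ act Π w γ → β ≈ᵥ γ)
    -- order reversing in both directions (anti-isomorphism)
    × (∀ β γ → InIF Φ Π θ S β → InIF Φ Π θ S γ →
         (β ≼[ Π ] γ → act Π w γ ≼[ Π ] act Π w β) × (act Π w γ ≼[ Π ] act Π w β → β ≼[ Π ] γ))
    -- minimum μ_S exists and w exchanges θ and μ_S
    × (∃[ μ ] (InIF Φ Π θ S μ × (∀ β → InIF Φ Π θ S β → μ ≼[ Π ] β)
         × act Π w θ ≈ᵥ μ × act Π w μ ≈ᵥ θ))
proposition2p7 N r Φ rs _ Π ss θ θ-highest S w w-longest =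
  (λ β → act-InF w W∋w) ,
  (λ γ γ∈F → act Π (reverse w) γ , act-InF (reverse w) W∋w⁻¹ γ∈F , act-reverse-inverseʳ w γ) ,
  (λ β γ _ _ → act-injective w) ,
  (λ β γ β∈F γ∈F → longestParabolic-antitone w-longest β∈F γ∈F ,
     λ wγ≼wβ → ≼-resp (act-reverse-inverseˡ w β) (act-reverse-inverseˡ w γ)
                 (longestParabolic-antitone w⁻¹-longest (act-InF w W∋w γ∈F) (act-InF w W∋w β∈F) wγ≼wβ)) ,
  (act Π w θ , act-InF w W∋w θ∈F , (λ β → longestParabolic-θ-least θ-highest w-longest) , ≋-refl ,
   ≋-trans (act-cong w wθ≈w⁻¹θ) (act-reverse-inverseʳ w θ))
  where
  open RootSystem Φ rs Π ss
  open Face θ S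
  w⁻¹-longest : IsLongestParabolic Π S (reverse w)
  w⁻¹-longest = IsLongestParabolic-reverse w-longest
  W∋w : InParabolic S w
  W∋w = proj₁ w-longest
  W∋w⁻¹ : InParabolic S (reverse w)
  W∋w⁻¹ = proj₁ w⁻¹-longest
  θ∈F : InF θ
  θ∈F = θ-InF θ-highest
  wθ≈w⁻¹θ : act Π w θ ≈ᵥ act Π (reverse w) θ
  wθ≈w⁻¹θ = ≼-antisym (longestParabolic-θ-least θ-highest w-longest (act-InF (reverse w) W∋w⁻¹ θ∈F))
                      (longestParabolic-θ-least θ-highest w⁻¹-longest (act-InF w W∋w θ∈F))
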